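{- Let $n\in\mathbb{N}$ be such that $d=\frac{2n-8}{3}$ is an even positive integer and $d\ge12$. Then there exists a (connected, simple) $d$-regular graph $G$ on $n$ vertices containing an edge $x\sim y$ with $\kappa(x,y)=0$ and $\kappa_0(x,y)<0$.
   Context: $d(u,v)$ is the shortest-path distance. For $\alpha\in[0,1]$, $\mu_u^\alpha$ is the probability measure with $\mu_u^\alpha(u)=\alpha$, $\mu_u^\alpha(v)=(1-\alpha)/\deg(u)$ for $v\sim u$, $0$ elsewhere; $W_1$ is the 1-Wasserstein distance w.r.t. the graph distance; $\kappa_\alpha(x,y)=1-W_1(\mu_x^\alpha,\mu_y^\alpha)/d(x,y)$ ($\kappa_0$ for $\alpha=0$), and the Lin–Lu–Yau curvature is $\kappa(x,y)=\lim_{\alpha\to1}\kappa_\alpha(x,y)/(1-\alpha)$.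
   Formalization: The parameter α in the limit defining $\kappa(x,y)$ is taken in the rationals, and the couplings over which $W_1$ is minimised are taken with rational values. -}

module Defs where

open import Data.Bool using (Bool; true; false; _∧_; _∨_; if_then_else_)
open import Data.Nat as ℕ using (ℕ; zero; suc)
open import Data.Fin using (Fin; zero; suc; _≟_)
open import Data.Integer using (+_)
open import Data.Rational using (ℚ; 0ℚ; 1ℚ; _+_; _*_; _-_; _/_; _≤_; _<_; ∣_∣)
open import Data.Product using (Σ; ∃; _×_)
open import Relation.Binary.PropositionalEquality using (_≡_)
open import Relation.Nullary.Decidable using (⌊_⌋)

sumFin : ∀ {A : Set} → (A → A → A) → A → ∀ {n} → (Fin n → A) → A
sumFin _⊕_ e {zero}  f = e
sumFin _⊕_ e {suc n} f = f zero ⊕ sumFin _⊕_ e (λ i → f (suc i))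

Σℚ : ∀ {n} → (Fin n → ℚ) → ℚ
Σℚ = sumFin _+_ 0ℚ

Σℕ : ∀ {n} → (Fin n → ℕ) → ℕ
Σℕ = sumFin ℕ._+_ 0

anyFin : ∀ {n} → (Fin n → Bool) → Bool
anyFin = sumFin _∨_ false

record SimpleGraph (n : ℕ) : Set where
  field
    adj   : Fin n → Fin n → Bool
    sym   : ∀ u v → adj u v ≡ adj v u
    irrefl : ∀ u → adj u u ≡ false
open SimpleGraph public

module _ {n : ℕ} (G : SimpleGraph n) where

  deg : Fin n → ℕ
  deg u = Σℕ (λ v → if adj G u v then 1 else 0)

  reach : ℕ → Fin n → Fin n → Bool
  reach zero    u v = ⌊ u ≟ v ⌋
  reach (suc k) u v = anyFin (λ w → reach k u w ∧ adj G w v)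

  reachWithin : ℕ → Fin n → Fin n → Bool
  reachWithin zero    u v = reach zero u v
  reachWithin (suc k) u v = reachWithin k u v ∨ reach (suc k) u v

  Connected : Set
  Connected = ∀ u v → Σ ℕ (λ k → reach k u v ≡ true)

  Regular : ℕ → Set
  Regular d = ∀ u → deg u ≡ d

  -- shortest-path distance: least k ≤ n with a walk of length k
  -- (returns n if no such k exists, i.e. never for connected graphs)
  distFrom : ℕ → ℕ → Fin n → Fin n → ℕ
  distFrom k zero    u v = k
  distFrom k (suc f) u v = if reach k u v then k else distFrom (suc k) f u v

  dist : Fin n → Fin n → ℕ
  dist u v = distFrom 0 (suc n) u v

  distℚ : Fin n → Fin n → ℚ
  distℚ u v = (+ dist u v) / 1

  μ : ℚ → Fin n → Fin n → ℚ
  μ α u v with ⌊ u ≟ v ⌋ | deg u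
  ... | true  | _     = α
  ... | false | zero  = 0ℚ
  ... | false | suc k = if adj G u v then (1ℚ - α) * ((+ 1) / suc k) else 0ℚ

  IsCoupling : (Fin n → ℚ) → (Fin n → ℚ) → (Fin n → Fin n → ℚ) → Set
  IsCoupling m₁ m₂ π =
    (∀ u v → 0ℚ ≤ π u v) ×
    (∀ u → Σℚ (λ v → π u v) ≡ m₁ u) ×
    (∀ v → Σℚ (λ u → π u v) ≡ m₂ v)

  cost : (Fin n → Fin n → ℚ) → ℚ
  cost π = Σℚ (λ u → Σℚ (λ v → π u v * distℚ u v))

  IsW1 : (Fin n → ℚ) → (Fin n → ℚ) → ℚ → Set
  IsW1 m₁ m₂ w =
    (Σ (Fin n → Fin n → ℚ) λ π → IsCoupling m₁ m₂ π × cost π ≡ w) ×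
    (∀ π → IsCoupling m₁ m₂ π → w ≤ cost π)

  -- κ_α(x,y) = k, i.e. k = 1 - W₁(μ_x^α, μ_y^α)/d(x,y)  (x ≠ y, so d(x,y) > 0)
  IsKappaα : ℚ → Fin n → Fin n → ℚ → Set
  IsKappaα α x y k =
    Σ ℚ λ w → IsW1 (μ α x) (μ α y) w × k * distℚ x y ≡ distℚ x y - w

  -- Lin–Lu–Yau curvature: κ(x,y) = L means κ_α(x,y)/(1-α) → L as α → 1⁻
  -- (|k/(1-α) - L| < ε written as |k - L(1-α)| < ε(1-α), valid since 1-α > 0)
  IsLLY : Fin n → Fin n → ℚ → Set
  IsLLY x y L =
    ∀ (ε : ℚ) → 0ℚ < ε →
      Σ ℚ λ δ → 0ℚ < δ ×
        (∀ (α : ℚ) → 1ℚ - δ < α → α < 1ℚ →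
          Σ ℚ λ k → IsKappaα α x y k ×
            ∣ k - L * (1ℚ - α) ∣ < ε * (1ℚ - α))

{-# OPTIONS --safe #-}

-- The graph has ten special vertices X, Y, A₁, A₂, A₃, Q, B₁, B₂, R₁, R₂ and three families T, A, B
-- of K = d/2 - 2 vertices: the T-vertices are common neighbours of X and Y, the A-vertices (like
-- A₁, A₂, A₃) private neighbours of X, the B-vertices (like Q, B₁, B₂) private neighbours of Y, and
-- each T-vertex misses two A-vertices, arranged cyclically, so that the graph is d-regular.
--
-- W₁(μ_X^α, μ_Y^α) is computed exactly by Kantorovich duality, from a transport plan that moves
-- mass along an involution of the vertices and an integer potential that is 1-Lipschitz along
-- edges and drops by exactly the travelled distance on every move.  Each neighbour of X or Y
-- carries ε = (1 - α)/d.  Both plans leave the T-vertices in place and move A_i ↦ B_i, A₂ ↦ B₂ (at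
-- distance 2) and A₃ ↦ Q (at distance 1).  For α > 1/2 they also move A₁ ↦ B₁ and the surplus
-- α - ε from X to Y, so W₁ = 1: κ_α(X, Y) = 0 near α = 1, hence κ(X, Y) = 0.  For α = 0 the mass
-- at Y goes to B₁ and the mass at A₁ to X, so W₁ = 1 + 1/d and κ₀(X, Y) = -1/d.

module Submission where

open import Defs hiding (sym)
open import Algebra.Bundles using (Monoid; CommutativeMonoid)
import Algebra.Properties.CommutativeSemigroup as CommutativeSemigroupProperties
open import Data.Bool using (Bool; true; false; not; _∧_; _∨_; if_then_else_)
import Data.Bool.Properties as Boolₚ
open import Data.Fin
  using (Fin; zero; suc; _↑ˡ_; _↑ʳ_; splitAt; combine; remQuot; fromℕ; inject₁; toℕ; lower₁; _≟_)
import Data.Fin.Properties as Finₚ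
open import Data.Fin.Patterns using (0F; 1F; 2F; 3F; 4F; 5F; 6F; 7F; 8F; 9F)
import Data.Integer as ℤ
import Data.Integer.Properties as ℤₚ
open import Data.Nat as ℕ using (ℕ; zero; suc; z≤n; s≤s)
import Data.Nat.Coprimality as Coprimality
open import Data.Nat.Divisibility using (divides)
import Data.Nat.Properties as ℕₚ
open import Data.Nat.Tactic.RingSolver using (solve-∀)
open import Data.Product using (Σ; ∃; ∃-syntax; _×_; _,_; proj₁; proj₂)
import Data.Product.Properties as Productₚ
open import Data.Rational using (ℚ; mkℚ; 0ℚ; 1ℚ; ½; _<_; *≤*; nonNegative; positive)
import Data.Rational.Properties as ℚₚ
open import Data.Rational.Solver using (module +-*-Solver)
open import Data.Sum as Sum using (_⊎_; inj₁; inj₂)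
open import Function using (_∘_)
open import Level using (0ℓ)
open import Relation.Binary.PropositionalEquality
open import Relation.Nullary using (Dec; yes; no; contradiction)
open import Relation.Nullary.Decidable using (⌊_⌋; ⌊⌋-map′; True; toWitness; _×-dec_; _→-dec_)

module General where

  open import Data.Rational using (_+_; _*_; _-_; -_; _/_; _≤_; ∣_∣)

  module SumFin (M : Monoid 0ℓ 0ℓ) where
    open Monoid M
      using (Carrier; _≈_; _∙_; ε; ∙-congˡ; assoc; identityˡ)
      renaming (refl to ≈-refl; sym to ≈-sym; trans to ≈-trans)

    sum : ∀ {n} → (Fin n → Carrier) → Carrier
    sum = sumFin _∙_ ε

    sum-cong : ∀ {n} {f g : Fin n → Carrier} → (∀ i → f i ≡ g i) → sum f ≡ sum g
    sum-cong {zero}  f≗g = refl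
    sum-cong {suc n} f≗g = cong₂ _∙_ (f≗g zero) (sum-cong (f≗g ∘ suc))

    sum-↑ : ∀ m {n} (f : Fin (m ℕ.+ n) → Carrier) →
            sum f ≈ sum (f ∘ (_↑ˡ n)) ∙ sum (f ∘ (m ↑ʳ_))
    sum-↑ zero    f = ≈-sym (identityˡ _)
    sum-↑ (suc m) f = ≈-trans (∙-congˡ (sum-↑ m (f ∘ suc))) (≈-sym (assoc _ _ _))

    sum-combine : ∀ m {n} (f : Fin (m ℕ.* n) → Carrier) →
                  sum f ≈ sum {m} (λ i → sum {n} (λ j → f (combine i j)))
    sum-combine zero        f = ≈-refl
    sum-combine (suc m) {n} f = ≈-trans (sum-↑ n f) (∙-congˡ (sum-combine m (f ∘ (n ↑ʳ_))))

  open SumFin ℚₚ.+-0-monoid public using () renaming (sum-cong to Σℚ-cong)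
  open SumFin ℕₚ.+-0-monoid public using ()
    renaming (sum-cong to Σℕ-cong; sum-↑ to Σℕ-↑; sum-combine to Σℕ-combine)

  Σℚ-zero : ∀ n → Σℚ {n} (λ _ → 0ℚ) ≡ 0ℚ
  Σℚ-zero zero    = refl
  Σℚ-zero (suc n) = cong (0ℚ +_) (Σℚ-zero n)

  Σℚ-distrib-+ : ∀ {n} (f g : Fin n → ℚ) → Σℚ (λ i → f i + g i) ≡ Σℚ f + Σℚ g
  Σℚ-distrib-+ {zero}  f g = refl
  Σℚ-distrib-+ {suc n} f g =
    trans (cong (f zero + g zero +_) (Σℚ-distrib-+ (f ∘ suc) (g ∘ suc))) (+-interchange (f zero) (g zero) _ _)
    where
    open CommutativeSemigroupProperties (CommutativeMonoid.commutativeSemigroup ℚₚ.+-0-commutativeMonoid)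
      renaming (interchange to +-interchange)

  Σℚ-neg : ∀ {n} (f : Fin n → ℚ) → Σℚ (λ i → - f i) ≡ - Σℚ f
  Σℚ-neg {zero}  f = refl
  Σℚ-neg {suc n} f =
    trans (cong (- f zero +_) (Σℚ-neg (f ∘ suc))) (sym (ℚₚ.neg-distrib-+ (f zero) _))

  Σℚ-distrib-- : ∀ {n} (f g : Fin n → ℚ) → Σℚ (λ i → f i - g i) ≡ Σℚ f - Σℚ g
  Σℚ-distrib-- f g = trans (Σℚ-distrib-+ f (λ i → - g i)) (cong (Σℚ f +_) (Σℚ-neg g))

  Σℚ-comm : ∀ {m n} (f : Fin m → Fin n → ℚ) →
            Σℚ (λ i → Σℚ (f i)) ≡ Σℚ (λ j → Σℚ (λ i → f i j))
  Σℚ-comm {zero}  {n} f = sym (Σℚ-zero n)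
  Σℚ-comm {suc m}     f = trans (cong (Σℚ (f zero) +_) (Σℚ-comm (f ∘ suc)))
                                (sym (Σℚ-distrib-+ (f zero) (λ j → Σℚ (λ i → f (suc i) j))))

  *-distribʳ-Σℚ : ∀ {n} (x : ℚ) (f : Fin n → ℚ) → Σℚ (λ i → f i * x) ≡ Σℚ f * x
  *-distribʳ-Σℚ {zero}  x f = sym (ℚₚ.*-zeroˡ x)
  *-distribʳ-Σℚ {suc n} x f = trans (cong (f zero * x +_) (*-distribʳ-Σℚ x (f ∘ suc)))
                                    (sym (ℚₚ.*-distribʳ-+ x (f zero) _))

  Σℚ-mono-≤ : ∀ {n} {f g : Fin n → ℚ} → (∀ i → f i ≤ g i) → Σℚ f ≤ Σℚ g
  Σℚ-mono-≤ {zero}  f≤g = ℚₚ.≤-refl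
  Σℚ-mono-≤ {suc n} f≤g = ℚₚ.+-mono-≤ (f≤g zero) (Σℚ-mono-≤ (f≤g ∘ suc))

  Σℕ-const : ∀ {n} c → Σℕ {n} (λ _ → c) ≡ n ℕ.* c
  Σℕ-const {zero}  c = refl
  Σℕ-const {suc n} c = cong (c ℕ.+_) (Σℕ-const {n} c)

  Σℕ-*ˡ : ∀ {n} k (f : Fin n → ℕ) → Σℕ (λ i → k ℕ.* f i) ≡ k ℕ.* Σℕ f
  Σℕ-*ˡ {zero}  k f = sym (ℕₚ.*-zeroʳ k)
  Σℕ-*ˡ {suc n} k f =
    trans (cong (k ℕ.* f zero ℕ.+_) (Σℕ-*ˡ k (f ∘ suc))) (sym (ℕₚ.*-distribˡ-+ k (f zero) _))

  ⌊⌋-⇔ : ∀ {a b} {P : Set a} {P′ : Set b} → (P → P′) → (P′ → P) →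
         (p? : Dec P) (p′? : Dec P′) → ⌊ p? ⌋ ≡ ⌊ p′? ⌋
  ⌊⌋-⇔ to from (yes p) (yes p′) = refl
  ⌊⌋-⇔ to from (yes p) (no ¬p′) = contradiction (to p) ¬p′
  ⌊⌋-⇔ to from (no ¬p) (yes p′) = contradiction (from p′) ¬p
  ⌊⌋-⇔ to from (no ¬p) (no ¬p′) = refl

  ⌊suc≟suc⌋ : ∀ {n} (i j : Fin n) → ⌊ suc i ≟ suc j ⌋ ≡ ⌊ i ≟ j ⌋
  ⌊suc≟suc⌋ i j = ⌊⌋-map′ _ _ (i ≟ j)

  ⌊≟⌋-refl : ∀ {n} (i : Fin n) → ⌊ i ≟ i ⌋ ≡ true
  ⌊≟⌋-refl i with i ≟ i
  ... | yes _  = refl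
  ... | no i≢i = contradiction refl i≢i

  ⌊≟⌋-sym : ∀ {n} (i j : Fin n) → ⌊ i ≟ j ⌋ ≡ ⌊ j ≟ i ⌋
  ⌊≟⌋-sym i j = ⌊⌋-⇔ sym sym (i ≟ j) (j ≟ i)

  ⌊≟⌋-true : ∀ {n} {i j : Fin n} → ⌊ i ≟ j ⌋ ≡ true → i ≡ j
  ⌊≟⌋-true {i = i} {j} e with i ≟ j
  ... | yes i≡j = i≡j

  Σℚ-indicator : ∀ {n} (u : Fin n) (f : Fin n → ℚ) →
                 Σℚ (λ v → if ⌊ u ≟ v ⌋ then f v else 0ℚ) ≡ f u
  Σℚ-indicator {suc n} zero    f = trans (cong (f zero +_) (Σℚ-zero n)) (ℚₚ.+-identityʳ (f zero))
  Σℚ-indicator {suc n} (suc u) f = begin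
    0ℚ + Σℚ (λ v → if ⌊ suc u ≟ suc v ⌋ then f (suc v) else 0ℚ)
      ≡⟨ ℚₚ.+-identityˡ _ ⟩
    Σℚ (λ v → if ⌊ suc u ≟ suc v ⌋ then f (suc v) else 0ℚ)
      ≡⟨ Σℚ-cong (λ v → cong (if_then f (suc v) else 0ℚ) (⌊suc≟suc⌋ u v)) ⟩
    Σℚ (λ v → if ⌊ u ≟ v ⌋ then f (suc v) else 0ℚ)
      ≡⟨ Σℚ-indicator u (f ∘ suc) ⟩
    f (suc u) ∎
    where open ≡-Reasoning

  ∧-true : ∀ {a b} → a ∧ b ≡ true → a ≡ true × b ≡ true
  ∧-true {true} {true} _ = refl , refl

  anyFin-intro : ∀ {n} (f : Fin n → Bool) w → f w ≡ true → anyFin f ≡ true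
  anyFin-intro f zero    fw = cong (_∨ anyFin (f ∘ suc)) fw
  anyFin-intro f (suc w) fw =
    trans (cong (f zero ∨_) (anyFin-intro (f ∘ suc) w fw)) (Boolₚ.∨-zeroʳ (f zero))

  anyFin-elim : ∀ {n} (f : Fin n → Bool) → anyFin f ≡ true → ∃ λ w → f w ≡ true
  anyFin-elim {suc n} f any with f zero in e
  ... | true  = zero , e
  ... | false with anyFin-elim (f ∘ suc) any
  ...   | w , fw = suc w , fw

  all-by-evaluation : ∀ {n p} {P : Fin n → Set p} (P? : ∀ i → Dec (P i)) →
                      {True (Finₚ.all? P?)} → ∀ i → P i
  all-by-evaluation P? {ok} = toWitness ok

  infix 7 _≢ᵇ_
  _≢ᵇ_ : ∀ {n} → Fin n → Fin n → Bool
  i ≢ᵇ j = not ⌊ i ≟ j ⌋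

  ≢ᵇ-sym : ∀ {n} (i j : Fin n) → (i ≢ᵇ j) ≡ (j ≢ᵇ i)
  ≢ᵇ-sym i j = cong not (⌊≟⌋-sym i j)

  count : ∀ {n} → (Fin n → Bool) → ℕ
  count p = Σℕ (λ i → if p i then 1 else 0)

  count-cong : ∀ {n} {p q : Fin n → Bool} → (∀ i → p i ≡ q i) → count p ≡ count q
  count-cong p≗q = Σℕ-cong (λ i → cong (if_then 1 else 0) (p≗q i))

  count-const : ∀ {n} b → count {n} (λ _ → b) ≡ n ℕ.* (if b then 1 else 0)
  count-const {n} b = Σℕ-const {n} (if b then 1 else 0)

  count-false : ∀ {n} → count {n} (λ _ → false) ≡ 0
  count-false {n} = trans (count-const {n} false) (ℕₚ.*-zeroʳ n)

  count-≢ : ∀ {n} (p : Fin (suc n)) → count (_≢ᵇ p) ≡ n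
  count-≢ {n}     zero    = trans (count-const {n} true) (ℕₚ.*-identityʳ n)
  count-≢ {suc n} (suc p) = cong suc (trans (count-cong λ i → cong not (⌊suc≟suc⌋ i p)) (count-≢ p))

  count-≢₂ : ∀ {n} (p q : Fin (2 ℕ.+ n)) → p ≢ q → count (λ i → i ≢ᵇ p ∧ i ≢ᵇ q) ≡ n
  count-≢₂ zero    zero    p≢q = contradiction refl p≢q
  count-≢₂ zero    (suc q) _   = trans (count-cong λ i → cong not (⌊suc≟suc⌋ i q)) (count-≢ q)
  count-≢₂ (suc p) zero    _   =
    trans (count-cong λ i → trans (Boolₚ.∧-identityʳ _) (cong not (⌊suc≟suc⌋ i p))) (count-≢ p)
  count-≢₂ {zero}  (suc zero) (suc zero) p≢q = contradiction refl p≢q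
  count-≢₂ {suc n} (suc p) (suc q) p≢q = cong suc (trans
    (count-cong λ i → cong₂ _∧_ (cong not (⌊suc≟suc⌋ i p)) (cong not (⌊suc≟suc⌋ i q)))
    (count-≢₂ p q (p≢q ∘ cong suc)))

  prev : ∀ {n} → Fin (suc n) → Fin (suc n)
  prev zero    = fromℕ _
  prev (suc i) = inject₁ i

  prev-injective : ∀ {n} {i j : Fin (suc n)} → prev i ≡ prev j → i ≡ j
  prev-injective {i = zero}  {zero}  _ = refl
  prev-injective {i = zero}  {suc j} e = contradiction e Finₚ.fromℕ≢inject₁
  prev-injective {i = suc i} {zero}  e = contradiction (sym e) Finₚ.fromℕ≢inject₁
  prev-injective {i = suc i} {suc j} e = cong suc (Finₚ.inject₁-injective e)

  prev-surjective : ∀ {n} (i : Fin (suc n)) → ∃ λ j → prev j ≡ i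
  prev-surjective {n} i with n ℕ.≟ toℕ i
  ... | yes n≡i = zero , Finₚ.toℕ-injective (trans (Finₚ.toℕ-fromℕ n) n≡i)
  ... | no  n≢i = suc (lower₁ i n≢i) , Finₚ.inject₁-lower₁ i n≢i

  prev-≢ : ∀ {n} (i : Fin (2 ℕ.+ n)) → prev i ≢ i
  prev-≢ zero    ()
  prev-≢ (suc i) e = ℕₚ.1+n≢n (trans (sym (cong toℕ e)) (Finₚ.toℕ-inject₁ i))

  count-≢-prev : ∀ {n} (i : Fin (2 ℕ.+ n)) → count (λ j → i ≢ᵇ j ∧ i ≢ᵇ prev j) ≡ n
  count-≢-prev i with prev-surjective i
  ... | j₀ , prev-j₀≡i =
    trans (count-cong λ j → cong₂ _∧_ (≢ᵇ-sym i j) (cong not (preimage j))) (count-≢₂ i j₀ i≢j₀)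
    where
    preimage : ∀ j → ⌊ i ≟ prev j ⌋ ≡ ⌊ j ≟ j₀ ⌋
    preimage j = ⌊⌋-⇔ (λ i≡prev-j → sym (prev-injective (trans prev-j₀≡i i≡prev-j)))
                      (λ j≡j₀ → trans (sym prev-j₀≡i) (cong prev (sym j≡j₀))) (i ≟ prev j) (j ≟ j₀)
    i≢j₀ : i ≢ j₀
    i≢j₀ i≡j₀ = prev-≢ i (trans (cong prev i≡j₀) prev-j₀≡i)

  toℚ : ℕ → ℚ
  toℚ n = ℤ.+ n / 1

  toℚ≡mkℚ : ∀ n → toℚ n ≡ mkℚ (ℤ.+ n) 0 (Coprimality.sym (Coprimality.1-coprimeTo n))
  toℚ≡mkℚ n = ℚₚ.normalize-coprime _

  toℚ-+ : ∀ m n → toℚ (m ℕ.+ n) ≡ toℚ m + toℚ n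
  toℚ-+ m n rewrite toℚ≡mkℚ m | toℚ≡mkℚ n =
    cong (_/ 1) (sym (cong₂ ℤ._+_ (ℤₚ.*-identityʳ (ℤ.+ m)) (ℤₚ.*-identityʳ (ℤ.+ n))))

  toℚ-* : ∀ m n → toℚ (m ℕ.* n) ≡ toℚ m * toℚ n
  toℚ-* m n rewrite toℚ≡mkℚ m | toℚ≡mkℚ n = cong (_/ 1) (ℤₚ.pos-* m n)

  toℚ-mono-≤ : ∀ {m n} → m ℕ.≤ n → toℚ m ≤ toℚ n
  toℚ-mono-≤ {m} {n} m≤n rewrite toℚ≡mkℚ m | toℚ≡mkℚ n =
    *≤* (subst₂ ℤ._≤_ (sym (ℤₚ.*-identityʳ _)) (sym (ℤₚ.*-identityʳ _)) (ℤ.+≤+ m≤n))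

  toℚ-nonneg : ∀ n → 0ℚ ≤ toℚ n
  toℚ-nonneg n = toℚ-mono-≤ {0} {n} z≤n

  1/suc≡mkℚ : ∀ d → ℤ.+ 1 / suc d ≡ mkℚ (ℤ.+ 1) d (Coprimality.1-coprimeTo (suc d))
  1/suc≡mkℚ d = ℚₚ.normalize-coprime (Coprimality.1-coprimeTo (suc d))

  1/suc-pos : ∀ d → 0ℚ < ℤ.+ 1 / suc d
  1/suc-pos d rewrite 1/suc≡mkℚ d = ℚₚ.positive⁻¹ _

  1/suc≤1 : ∀ d → ℤ.+ 1 / suc d ≤ 1ℚ
  1/suc≤1 d rewrite 1/suc≡mkℚ d = *≤* (ℤ.+≤+ (s≤s z≤n))

  toℚ-inverse : ∀ d → toℚ (suc d) * (ℤ.+ 1 / suc d) ≡ 1ℚ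
  toℚ-inverse d rewrite toℚ≡mkℚ (suc d) | 1/suc≡mkℚ d =
    ℚₚ.*-inverseʳ (mkℚ (ℤ.+ suc d) 0 (Coprimality.sym (Coprimality.1-coprimeTo (suc d))))

  [p+q]-q≡p : ∀ p q → (p + q) - q ≡ p
  [p+q]-q≡p p q =
    trans (ℚₚ.+-assoc p q (- q)) (trans (cong (p +_) (ℚₚ.+-inverseʳ q)) (ℚₚ.+-identityʳ p))

  p≤q+r⇒p-r≤q : ∀ {p q r} → p ≤ q + r → p - r ≤ q
  p≤q+r⇒p-r≤q {p} {q} {r} p≤q+r = subst (p - r ≤_) ([p+q]-q≡p q r) (ℚₚ.+-monoˡ-≤ (- r) p≤q+r)

  p<q⇒0<q-p : ∀ {p q} → p < q → 0ℚ < q - p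
  p<q⇒0<q-p {p} {q} p<q = subst (_< q - p) (ℚₚ.+-inverseʳ p) (ℚₚ.+-monoˡ-< (- p) p<q)

  p≤q⇒0≤q-p : ∀ {p q} → p ≤ q → 0ℚ ≤ q - p
  p≤q⇒0≤q-p {p} {q} p≤q = subst (_≤ q - p) (ℚₚ.+-inverseʳ p) (ℚₚ.+-monoˡ-≤ (- p) p≤q)

  *-nonneg : ∀ {p q} → 0ℚ ≤ p → 0ℚ ≤ q → 0ℚ ≤ p * q
  *-nonneg {p} {q} p≥0 q≥0 =
    ℚₚ.nonNegative⁻¹ _ {{ℚₚ.nonNeg*nonNeg⇒nonNeg p {{nonNegative p≥0}} q {{nonNegative q≥0}}}}

  *-distribˡ-- : ∀ a b c → a * (b - c) ≡ a * b - a * c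
  *-distribˡ-- a b c =
    trans (ℚₚ.*-distribˡ-+ a b (- c)) (cong (a * b +_) (sym (ℚₚ.neg-distribʳ-* a c)))

  if-* : ∀ b {p} q → (if b then p else 0ℚ) * q ≡ (if b then p * q else 0ℚ)
  if-* true  q = refl
  if-* false q = ℚₚ.*-zeroˡ q

  if-nonneg : ∀ b {p} → 0ℚ ≤ p → 0ℚ ≤ (if b then p else 0ℚ)
  if-nonneg true  p≥0 = p≥0
  if-nonneg false _   = ℚₚ.≤-refl

  module Distance {n} (G : SimpleGraph n) where

    EdgeLipschitz : (Fin n → ℕ) → Set
    EdgeLipschitz ℓ = ∀ u v → adj G u v ≡ true → ℓ u ℕ.≤ suc (ℓ v)

    ShortWalks : Set
    ShortWalks = ∀ u v → ∃[ k ] k ℕ.≤ n × reach G k u v ≡ true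

    reach-snoc : ∀ {k u w v} → reach G k u w ≡ true → adj G w v ≡ true →
                 reach G (suc k) u v ≡ true
    reach-snoc {k} {u} {w} {v} r e =
      anyFin-intro (λ z → reach G k u z ∧ adj G z v) w (cong₂ _∧_ r e)

    reach-snoc⁻¹ : ∀ {k u v} → reach G (suc k) u v ≡ true →
                   ∃ λ w → reach G k u w ≡ true × adj G w v ≡ true
    reach-snoc⁻¹ {k} {u} {v} r with anyFin-elim (λ z → reach G k u z ∧ adj G z v) r
    ... | w , e = w , ∧-true e

    distFrom-shortest : ∀ {u v} j fuel {k} → j ℕ.≤ k → k ℕ.< j ℕ.+ fuel → reach G k u v ≡ true →
                        distFrom G j fuel u v ℕ.≤ k × reach G (distFrom G j fuel u v) u v ≡ true
    distFrom-shortest j zero {k} j≤k k<j+0 r =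
      contradiction j≤k (ℕₚ.<⇒≱ (subst (k ℕ.<_) (ℕₚ.+-identityʳ j) k<j+0))
    distFrom-shortest {u} {v} j (suc fuel) {k} j≤k k<j+1+fuel r with reach G j u v in e
    ... | true  = j≤k , e
    ... | false =
      distFrom-shortest (suc j) fuel (ℕₚ.≤∧≢⇒< j≤k j≢k)
                        (subst (k ℕ.<_) (ℕₚ.+-suc j fuel) k<j+1+fuel) r
      where
      j≢k : j ≢ k
      j≢k refl = contradiction (trans (sym e) r) λ ()

    dist-shortest : ∀ {k u v} → reach G k u v ≡ true → k ℕ.≤ n →
                    dist G u v ℕ.≤ k × reach G (dist G u v) u v ≡ true
    dist-shortest r k≤n = distFrom-shortest 0 (suc n) z≤n (s≤s k≤n) r

    dist-refl : ∀ u → dist G u u ≡ 0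
    dist-refl u rewrite ⌊≟⌋-refl u = refl

    walk-lipschitz : ∀ {ℓ} → EdgeLipschitz ℓ →
                     ∀ k {u v} → reach G k u v ≡ true → ℓ u ℕ.≤ k ℕ.+ ℓ v
    walk-lipschitz lip zero r rewrite ⌊≟⌋-true r = ℕₚ.≤-refl
    walk-lipschitz {ℓ} lip (suc k) {u} {v} r with reach-snoc⁻¹ {k} {u} {v} r
    ... | w , r′ , e = begin
      ℓ u             ≤⟨ walk-lipschitz {ℓ} lip k r′ ⟩
      k ℕ.+ ℓ w       ≤⟨ ℕₚ.+-monoʳ-≤ k (lip w v e) ⟩
      k ℕ.+ suc (ℓ v) ≡⟨ ℕₚ.+-suc k (ℓ v) ⟩
      suc k ℕ.+ ℓ v   ∎
      where open ℕₚ.≤-Reasoning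

    dist-lipschitz : ∀ {ℓ} → ShortWalks → EdgeLipschitz ℓ →
                     ∀ u v → ℓ u ℕ.≤ dist G u v ℕ.+ ℓ v
    dist-lipschitz {ℓ} walks lip u v with walks u v
    ... | k , k≤n , r = walk-lipschitz {ℓ} lip (dist G u v) (proj₂ (dist-shortest {k} r k≤n))

    dist-tight : ∀ {ℓ k u v} → EdgeLipschitz ℓ → reach G k u v ≡ true → k ℕ.≤ n →
                 ℓ u ≡ k ℕ.+ ℓ v → dist G u v ≡ k
    dist-tight {ℓ} {k} {u} {v} lip r k≤n ℓu≡k+ℓv with dist-shortest {k} r k≤n
    ... | d≤k , r′ = ℕₚ.≤-antisym d≤k (ℕₚ.+-cancelʳ-≤ (ℓ v) k _
      (subst (ℕ._≤ dist G u v ℕ.+ ℓ v) ℓu≡k+ℓv (walk-lipschitz {ℓ} lip (dist G u v) r′)))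

    potential-lipschitz : ∀ {ℓ} → ShortWalks → EdgeLipschitz ℓ →
                          ∀ u v → toℚ (ℓ u) - toℚ (ℓ v) ≤ distℚ G u v
    potential-lipschitz {ℓ} walks lip u v = p≤q+r⇒p-r≤q (subst (toℚ (ℓ u) ≤_) (toℚ-+ (dist G u v) (ℓ v))
                                                              (toℚ-mono-≤ (dist-lipschitz {ℓ} walks lip u v)))

    potential-tight : ∀ {ℓ k u v} → EdgeLipschitz ℓ → reach G k u v ≡ true → k ℕ.≤ n →
                      ℓ u ≡ k ℕ.+ ℓ v → toℚ (ℓ u) - toℚ (ℓ v) ≡ distℚ G u v
    potential-tight {ℓ} {k} {u} {v} lip r k≤n ℓu≡k+ℓv = begin
      toℚ (ℓ u) - toℚ (ℓ v)           ≡⟨ cong (λ z → toℚ z - toℚ (ℓ v)) ℓu≡k+ℓv ⟩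
      toℚ (k ℕ.+ ℓ v) - toℚ (ℓ v)     ≡⟨ cong (_- toℚ (ℓ v)) (toℚ-+ k (ℓ v)) ⟩
      (toℚ k + toℚ (ℓ v)) - toℚ (ℓ v) ≡⟨ [p+q]-q≡p (toℚ k) (toℚ (ℓ v)) ⟩
      toℚ k                           ≡⟨ cong toℚ (sym (dist-tight {ℓ} lip r k≤n ℓu≡k+ℓv)) ⟩
      distℚ G u v                     ∎
      where open ≡-Reasoning

  module Transport {n} (G : SimpleGraph n) where
    open Distance G

    μ-regular : ∀ {d} → Regular G (suc d) → ∀ α u v →
                μ G α u v ≡ (if ⌊ u ≟ v ⌋ then α
                             else if adj G u v then (1ℚ - α) * (ℤ.+ 1 / suc d) else 0ℚ)
    μ-regular regular α u v with ⌊ u ≟ v ⌋ | deg G u | regular u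
    ... | true  | _        | _    = refl
    ... | false | .(suc _) | refl = refl

    pairing : (π c : Fin n → Fin n → ℚ) → ℚ
    pairing π c = Σℚ λ u → Σℚ λ v → π u v * c u v

    pairing-mono-≤ : ∀ {π c c′} → (∀ u v → 0ℚ ≤ π u v) → (∀ u v → c u v ≤ c′ u v) →
                     pairing π c ≤ pairing π c′
    pairing-mono-≤ {π} π≥0 c≤c′ = Σℚ-mono-≤ λ u → Σℚ-mono-≤ λ v →
      ℚₚ.*-monoˡ-≤-nonNeg (π u v) {{nonNegative (π≥0 u v)}} (c≤c′ u v)

    pairing-potential : ∀ {m₁ m₂ π} (F : Fin n → ℚ) → IsCoupling G m₁ m₂ π →
      pairing π (λ u v → F u - F v) ≡ Σℚ (λ u → m₁ u * F u) - Σℚ (λ u → m₂ u * F u)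
    pairing-potential {m₁} {m₂} {π} F (_ , row , col) = begin
      Σℚ (λ u → Σℚ (λ v → π u v * (F u - F v)))
        ≡⟨ Σℚ-cong (λ u → trans (Σℚ-cong λ v → *-distribˡ-- (π u v) (F u) (F v))
                                (Σℚ-distrib-- (λ v → π u v * F u) (λ v → π u v * F v))) ⟩
      Σℚ (λ u → Σℚ (λ v → π u v * F u) - Σℚ (λ v → π u v * F v))
        ≡⟨ Σℚ-distrib-- (λ u → Σℚ (λ v → π u v * F u)) (λ u → Σℚ (λ v → π u v * F v)) ⟩
      Σℚ (λ u → Σℚ (λ v → π u v * F u)) - Σℚ (λ u → Σℚ (λ v → π u v * F v))
        ≡⟨ cong₂ _-_ (Σℚ-cong rows) (trans (Σℚ-comm (λ u v → π u v * F v)) (Σℚ-cong cols)) ⟩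
      Σℚ (λ u → m₁ u * F u) - Σℚ (λ v → m₂ v * F v) ∎
      where
      open ≡-Reasoning
      rows : ∀ u → Σℚ (λ v → π u v * F u) ≡ m₁ u * F u
      rows u = trans (*-distribʳ-Σℚ (F u) (π u)) (cong (_* F u) (row u))
      cols : ∀ v → Σℚ (λ u → π u v * F v) ≡ m₂ v * F v
      cols v = trans (*-distribʳ-Σℚ (F v) (λ u → π u v)) (cong (_* F v) (col v))

    weak-duality : ∀ {m₁ m₂ π} (F : Fin n → ℚ) → (∀ u v → F u - F v ≤ distℚ G u v) →
                   IsCoupling G m₁ m₂ π → Σℚ (λ u → m₁ u * F u) - Σℚ (λ u → m₂ u * F u) ≤ cost G π
    weak-duality F F-lip coupling@(π≥0 , _) =
      subst (_≤ _) (pairing-potential F coupling) (pairing-mono-≤ π≥0 F-lip)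

    W1-certificate : ∀ {m₁ m₂ π} (F : Fin n → ℚ) → (∀ u v → F u - F v ≤ distℚ G u v) →
                     IsCoupling G m₁ m₂ π → cost G π ≡ pairing π (λ u v → F u - F v) →
                     IsW1 G m₁ m₂ (cost G π)
    W1-certificate {π = π} F F-lip coupling optimal =
      (π , coupling , refl) ,
      λ π′ coupling′ → subst (_≤ cost G π′) (sym (trans optimal (pairing-potential F coupling)))
                              (weak-duality F F-lip coupling′)

    IsW1-cong : ∀ {m₁ m₁′ m₂ m₂′ w} → (∀ u → m₁ u ≡ m₁′ u) → (∀ u → m₂ u ≡ m₂′ u) →
                IsW1 G m₁ m₂ w → IsW1 G m₁′ m₂′ w
    IsW1-cong m₁≗ m₂≗ ((π , (π≥0 , rows , cols) , cost≡w) , minimal) =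
      (π , (π≥0 , (λ u → trans (rows u) (m₁≗ u)) , (λ v → trans (cols v) (m₂≗ v))) , cost≡w) ,
      λ π′ (π′≥0 , rows′ , cols′) →
        minimal π′ (π′≥0 , (λ u → trans (rows′ u) (sym (m₁≗ u))) ,
                           (λ v → trans (cols′ v) (sym (m₂≗ v))))

    module InvolutionPlan (σ : Fin n → Fin n) (σ-involutive : ∀ u → σ (σ u) ≡ u)
                          (h g : Fin n → ℚ) where

      stay move plan : Fin n → Fin n → ℚ
      stay u v = if ⌊ u ≟ v ⌋ then h u else 0ℚ
      move u v = if ⌊ σ u ≟ v ⌋ then g u else 0ℚ
      plan u v = stay u v + move u v

      ⌊σ≟⌋-swap : ∀ u v → ⌊ σ u ≟ v ⌋ ≡ ⌊ σ v ≟ u ⌋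
      ⌊σ≟⌋-swap u v = ⌊⌋-⇔ (λ σu≡v → trans (cong σ (sym σu≡v)) (σ-involutive u))
                           (λ σv≡u → trans (cong σ (sym σv≡u)) (σ-involutive v)) (σ u ≟ v) (σ v ≟ u)

      plan-isCoupling : (∀ u → 0ℚ ≤ h u) → (∀ u → 0ℚ ≤ g u) →
                        IsCoupling G (λ u → h u + g u) (λ v → h v + g (σ v)) plan
      plan-isCoupling h≥0 g≥0 = nonneg , row , col
        where
        nonneg : ∀ u v → 0ℚ ≤ plan u v
        nonneg u v = ℚₚ.+-mono-≤ (if-nonneg ⌊ u ≟ v ⌋ (h≥0 u)) (if-nonneg ⌊ σ u ≟ v ⌋ (g≥0 u))
        row : ∀ u → Σℚ (plan u) ≡ h u + g u
        row u = trans (Σℚ-distrib-+ (stay u) (move u))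
                      (cong₂ _+_ (Σℚ-indicator u (λ _ → h u)) (Σℚ-indicator (σ u) (λ _ → g u)))
        col : ∀ v → Σℚ (λ u → plan u v) ≡ h v + g (σ v)
        col v = trans (Σℚ-distrib-+ (λ u → stay u v) (λ u → move u v)) (cong₂ _+_
          (trans (Σℚ-cong λ u → cong (if_then h u else 0ℚ) (⌊≟⌋-sym u v)) (Σℚ-indicator v h))
          (trans (Σℚ-cong λ u → cong (if_then g u else 0ℚ) (⌊σ≟⌋-swap u v)) (Σℚ-indicator (σ v) g)))

      pairing-plan : ∀ c → (∀ u → c u u ≡ 0ℚ) → pairing plan c ≡ Σℚ (λ u → g u * c u (σ u))
      pairing-plan c c-diag = Σℚ-cong λ u → begin
        Σℚ (λ v → plan u v * c u v)
          ≡⟨ Σℚ-cong (λ v → ℚₚ.*-distribʳ-+ (c u v) (stay u v) (move u v)) ⟩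
        Σℚ (λ v → stay u v * c u v + move u v * c u v)
          ≡⟨ Σℚ-distrib-+ (λ v → stay u v * c u v) (λ v → move u v * c u v) ⟩
        Σℚ (λ v → stay u v * c u v) + Σℚ (λ v → move u v * c u v)
          ≡⟨ cong₂ _+_
               (trans (Σℚ-cong λ v → if-* ⌊ u ≟ v ⌋ (c u v)) (Σℚ-indicator u (λ v → h u * c u v)))
               (trans (Σℚ-cong λ v → if-* ⌊ σ u ≟ v ⌋ (c u v)) (Σℚ-indicator (σ u) (λ v → g u * c u v))) ⟩
        h u * c u u + g u * c u (σ u)
          ≡⟨ cong (λ z → h u * z + g u * c u (σ u)) (c-diag u) ⟩
        h u * 0ℚ + g u * c u (σ u)
          ≡⟨ trans (cong (_+ g u * c u (σ u)) (ℚₚ.*-zeroʳ (h u))) (ℚₚ.+-identityˡ _) ⟩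
        g u * c u (σ u) ∎
        where open ≡-Reasoning

      plan-W1 : (∀ u → 0ℚ ≤ h u) → (∀ u → 0ℚ ≤ g u) →
                (F : Fin n → ℚ) → (∀ u v → F u - F v ≤ distℚ G u v) →
                (∀ u → g u * (F u - F (σ u)) ≡ g u * distℚ G u (σ u)) →
                IsW1 G (λ u → h u + g u) (λ v → h v + g (σ v)) (Σℚ λ u → g u * distℚ G u (σ u))
      plan-W1 h≥0 g≥0 F F-lip slack =
        subst (IsW1 G _ _) cost≡ (W1-certificate F F-lip (plan-isCoupling h≥0 g≥0) optimal)
        where
        cost≡ : cost G plan ≡ Σℚ (λ u → g u * distℚ G u (σ u))
        cost≡ = pairing-plan (distℚ G) (λ u → cong toℚ (dist-refl u))
        optimal : cost G plan ≡ pairing plan (λ u v → F u - F v)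
        optimal = trans cost≡ (trans (Σℚ-cong (sym ∘ slack))
                                     (sym (pairing-plan (λ u v → F u - F v) (λ u → ℚₚ.+-inverseʳ (F u)))))

  module Curvature {n} (G : SimpleGraph n) {x y : Fin n} (unit-distance : distℚ G x y ≡ 1ℚ) where

    κ-from-W1 : ∀ {α w} → IsW1 G (μ G α x) (μ G α y) w → IsKappaα G α x y (1ℚ - w)
    κ-from-W1 {α} {w} W1 = w , W1 , (begin
      (1ℚ - w) * distℚ G x y ≡⟨ cong ((1ℚ - w) *_) unit-distance ⟩
      (1ℚ - w) * 1ℚ          ≡⟨ ℚₚ.*-identityʳ _ ⟩
      1ℚ - w                 ≡⟨ cong (_- w) (sym unit-distance) ⟩
      distℚ G x y - w        ∎)
      where open ≡-Reasoning

    LLY-zero : (δ : ℚ) → 0ℚ < δ → (∀ α → 1ℚ - δ < α → α < 1ℚ → IsKappaα G α x y 0ℚ) →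
               IsLLY G x y 0ℚ
    LLY-zero δ δ>0 vanishing ε ε>0 = δ , δ>0 , λ α lo α<1 → 0ℚ , vanishing α lo α<1 , bound α α<1
      where
      bound : ∀ α → α < 1ℚ → ∣ 0ℚ - 0ℚ * (1ℚ - α) ∣ < ε * (1ℚ - α)
      bound α α<1 rewrite ℚₚ.*-zeroˡ (1ℚ - α) =
        subst (_< ε * (1ℚ - α)) (ℚₚ.*-zeroˡ (1ℚ - α))
              (ℚₚ.*-monoˡ-<-pos (1ℚ - α) {{positive (p<q⇒0<q-p α<1)}} ε>0)

  -- the mass c₁ β + c₂ ε, recorded by its coefficients (c₁ , c₂) so that identities between masses
  -- can be decided by evaluation
  Mass : Set
  Mass = ℕ × ℕ

  infixl 6 _⊕_
  _⊕_ : Mass → Mass → Mass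
  (a , b) ⊕ (c , d) = a ℕ.+ c , b ℕ.+ d

  infixr 7 _·_
  _·_ : ℕ → Mass → Mass
  k · (a , b) = k ℕ.* a , k ℕ.* b

  infix 4 _≟ᴹ_
  _≟ᴹ_ : (m m′ : Mass) → Dec (m ≡ m′)
  _≟ᴹ_ = Productₚ.≡-dec ℕ._≟_ ℕ._≟_

  module MassValue (β ε : ℚ) where

    ⟦_⟧ : Mass → ℚ
    ⟦ a , b ⟧ = toℚ a * β + toℚ b * ε

    ⟦0⟧ : ⟦ 0 , 0 ⟧ ≡ 0ℚ
    ⟦0⟧ = cong₂ _+_ (ℚₚ.*-zeroˡ β) (ℚₚ.*-zeroˡ ε)

    ⟦0⟧-* : ∀ {m} → m ≡ (0 , 0) → ∀ q → ⟦ m ⟧ * q ≡ 0ℚ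
    ⟦0⟧-* refl q = trans (cong (_* q) ⟦0⟧) (ℚₚ.*-zeroˡ q)

    ⟦⟧-⊕ : ∀ m m′ → ⟦ m ⊕ m′ ⟧ ≡ ⟦ m ⟧ + ⟦ m′ ⟧
    ⟦⟧-⊕ (a , b) (c , d) = trans (cong₂ _+_ (split a c β) (split b d ε))
                                (+-interchange (toℚ a * β) (toℚ c * β) (toℚ b * ε) (toℚ d * ε))
      where
      open CommutativeSemigroupProperties (CommutativeMonoid.commutativeSemigroup ℚₚ.+-0-commutativeMonoid)
        renaming (interchange to +-interchange)
      split : ∀ m n x → toℚ (m ℕ.+ n) * x ≡ toℚ m * x + toℚ n * x
      split m n x = trans (cong (_* x) (toℚ-+ m n)) (ℚₚ.*-distribʳ-+ x (toℚ m) (toℚ n))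

    ⟦⟧-· : ∀ k m → toℚ k * ⟦ m ⟧ ≡ ⟦ k · m ⟧
    ⟦⟧-· k (a , b) = trans (ℚₚ.*-distribˡ-+ (toℚ k) _ _) (cong₂ _+_ (scale a β) (scale b ε))
      where
      scale : ∀ n x → toℚ k * (toℚ n * x) ≡ toℚ (k ℕ.* n) * x
      scale n x = trans (sym (ℚₚ.*-assoc (toℚ k) (toℚ n) x)) (cong (_* x) (sym (toℚ-* k n)))

    ⟦⟧-nonneg : 0ℚ ≤ β → 0ℚ ≤ ε → ∀ m → 0ℚ ≤ ⟦ m ⟧
    ⟦⟧-nonneg β≥0 ε≥0 (a , b) =
      ℚₚ.+-mono-≤ (*-nonneg (toℚ-nonneg a) β≥0) (*-nonneg (toℚ-nonneg b) ε≥0)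

    Σℚ-⟦⟧ : ∀ {n} (c : Fin n → Mass) →
            Σℚ (λ i → ⟦ c i ⟧) ≡ ⟦ Σℕ (proj₁ ∘ c) , Σℕ (proj₂ ∘ c) ⟧
    Σℚ-⟦⟧ {zero}  c = sym ⟦0⟧
    Σℚ-⟦⟧ {suc n} c = trans (cong (⟦ c zero ⟧ +_) (Σℚ-⟦⟧ (c ∘ suc))) (sym (⟦⟧-⊕ (c zero) _))

CurvatureExample : ℕ → ℕ → Set
CurvatureExample n d =
  Σ (SimpleGraph n) λ G → Connected G × Regular G d ×
    Σ (Fin n) λ x → Σ (Fin n) λ y → adj G x y ≡ true ×
      IsLLY G x y 0ℚ ×
      Σ ℚ λ k → IsKappaα G 0ℚ x y k × k < 0ℚ

module Construction (m : ℕ) where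

  open General
  open import Data.Rational using (_+_; _*_; _-_; -_; _/_; _≤_)

  K D-1 D N : ℕ
  K   = 2 ℕ.+ m
  D-1 = 3 ℕ.+ K ℕ.* 2
  D   = suc D-1
  N   = 10 ℕ.+ 3 ℕ.* K

  pattern X  = 0F
  pattern Y  = 1F
  pattern A₁ = 2F
  pattern A₂ = 3F
  pattern A₃ = 4F
  pattern Q  = 5F
  pattern B₁ = 6F
  pattern B₂ = 7F
  pattern R₁ = 8F
  pattern R₂ = 9F

  pattern T = 0F
  pattern A = 1F
  pattern B = 2F

  Vertex : Set
  Vertex = Fin 10 ⊎ Fin 3 × Fin K

  pattern special s = inj₁ s
  pattern member f i = inj₂ (f , i)

  edge : Fin 10 → Fin 10 → Bool
  edge X  Y  = true
  edge X  A₁ = true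
  edge X  A₂ = true
  edge X  A₃ = true
  edge Y  Q  = true
  edge Y  B₁ = true
  edge Y  B₂ = true
  edge A₁ A₂ = true
  edge A₁ R₁ = true
  edge A₁ R₂ = true
  edge A₂ R₁ = true
  edge A₂ R₂ = true
  edge A₃ Q  = true
  edge A₃ R₁ = true
  edge A₃ R₂ = true
  edge Q  B₁ = true
  edge Q  B₂ = true
  edge B₁ B₂ = true
  edge B₁ R₂ = true
  edge B₂ R₁ = true
  edge _  _  = false

  joins : Fin 10 → Fin 3 → Bool
  joins X  T = true
  joins X  A = true
  joins Y  T = true
  joins Y  B = true
  joins A₁ T = true
  joins A₁ A = true
  joins A₂ T = true
  joins A₂ A = true
  joins A₃ T = true
  joins A₃ A = true
  joins Q  A = true
  joins Q  B = true
  joins B₁ T = true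
  joins B₁ B = true
  joins B₂ T = true
  joins B₂ B = true
  joins R₁ A = true
  joins R₁ B = true
  joins R₂ A = true
  joins R₂ B = true
  joins _  _ = false

  adjF : Fin 3 → Fin 3 → Fin K → Fin K → Bool
  adjF T A i j = j ≢ᵇ i ∧ j ≢ᵇ prev i
  adjF A T i j = i ≢ᵇ j ∧ i ≢ᵇ prev j
  adjF T B i j = j ≢ᵇ i
  adjF B T i j = i ≢ᵇ j
  adjF A A i j = j ≢ᵇ i
  adjF B B i j = j ≢ᵇ i
  adjF _ _ _ _ = false

  adjV : Vertex → Vertex → Bool
  adjV (special s)  (special s′) = edge s s′ ∨ edge s′ s
  adjV (special s)  (member f _) = joins s f
  adjV (member f _) (special s)  = joins s f
  adjV (member f i) (member g j) = adjF f g i j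

  all-vertices-by-evaluation : ∀ {P : Vertex → Set} (P? : ∀ w → Dec (P w)) →
    {True (Finₚ.all? (P? ∘ special))} → {∀ i → True (Finₚ.all? (λ f → P? (member f i)))} → ∀ w → P w
  all-vertices-by-evaluation P? {specials} {members} (special s)  = toWitness specials s
  all-vertices-by-evaluation P? {specials} {members} (member f i) = toWitness (members i) f

  adjF-sym : ∀ f g i j → adjF f g i j ≡ adjF g f j i
  adjF-sym T T _ _ = refl
  adjF-sym T A _ _ = refl
  adjF-sym T B _ _ = refl
  adjF-sym A T _ _ = refl
  adjF-sym A A i j = ≢ᵇ-sym j i
  adjF-sym A B _ _ = refl
  adjF-sym B T _ _ = refl
  adjF-sym B A _ _ = refl
  adjF-sym B B i j = ≢ᵇ-sym j i

  adjV-sym : ∀ w v → adjV w v ≡ adjV v w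
  adjV-sym (special s)  (special s′) = Boolₚ.∨-comm (edge s s′) (edge s′ s)
  adjV-sym (special s)  (member f _) = refl
  adjV-sym (member f _) (special s)  = refl
  adjV-sym (member f i) (member g j) = adjF-sym f g i j

  adjV-irrefl : ∀ w → adjV w w ≡ false
  adjV-irrefl (special s)  = all-by-evaluation (λ s → adjV (special s) (special s) Boolₚ.≟ false) s
  adjV-irrefl (member T i) = refl
  adjV-irrefl (member A i) = cong not (⌊≟⌋-refl i)
  adjV-irrefl (member B i) = cong not (⌊≟⌋-refl i)

  enc : Vertex → Fin N
  enc (special s)  = s ↑ˡ 3 ℕ.* K
  enc (member f i) = 10 ↑ʳ combine f i

  dec : Fin N → Vertex
  dec u = Sum.map₂ (remQuot K) (splitAt 10 u)

  dec-enc : ∀ w → dec (enc w) ≡ w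
  dec-enc (special s)  = cong (Sum.map₂ (remQuot K)) (Finₚ.splitAt-↑ˡ 10 s (3 ℕ.* K))
  dec-enc (member f i) = trans (cong (Sum.map₂ (remQuot K)) (Finₚ.splitAt-↑ʳ 10 (3 ℕ.* K) (combine f i)))
                               (cong inj₂ (Finₚ.remQuot-combine f i))

  enc-dec : ∀ u → enc (dec u) ≡ u
  enc-dec u with splitAt 10 u in e
  ... | inj₁ s = Finₚ.splitAt⁻¹-↑ˡ e
  ... | inj₂ r = trans (cong (10 ↑ʳ_) (Finₚ.combine-remQuot {3} K r)) (Finₚ.splitAt⁻¹-↑ʳ e)

  G : SimpleGraph N
  G = record
    { adj    = λ u v → adjV (dec u) (dec v)
    ; sym    = λ u v → adjV-sym (dec u) (dec v)
    ; irrefl = λ u → adjV-irrefl (dec u)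
    }

  x y : Fin N
  x = enc (special X)
  y = enc (special Y)

  adj-enc : ∀ w v → adj G (enc w) (enc v) ≡ adjV w v
  adj-enc w v = cong₂ adjV (dec-enc w) (dec-enc v)

  Σℕ-vertices : (c : Vertex → ℕ) →
                Σℕ (c ∘ dec) ≡ Σℕ (c ∘ special) ℕ.+ Σℕ (λ f → Σℕ (λ i → c (member f i)))
  Σℕ-vertices c = trans (Σℕ-↑ 10 {3 ℕ.* K} (c ∘ dec)) (cong₂ ℕ._+_
    (Σℕ-cong λ s → cong c (dec-enc (special s)))
    (trans (Σℕ-combine 3 {K} (c ∘ dec ∘ (10 ↑ʳ_)))
           (Σℕ-cong λ f → Σℕ-cong λ i → cong c (dec-enc (member f i)))))

  representative : Fin 3 → Vertex
  representative f = member f zero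

  Σℕ-families : (c : Fin 3 → ℕ) → Σℕ (λ f → Σℕ {K} (λ _ → c f)) ≡ K ℕ.* Σℕ c
  Σℕ-families c = trans (Σℕ-cong (λ f → Σℕ-const {K} (c f))) (Σℕ-*ˡ K c)

  degree : ∀ w → count (λ s → adjV w (special s)) ℕ.+ Σℕ (λ f → count (λ i → adjV w (member f i))) ≡ D
  degree (special s) = cong₂ ℕ._+_
    (all-by-evaluation (λ s → count (λ s′ → adjV (special s) (special s′)) ℕ.≟ 4) s)
    (trans (Σℕ-families (λ f → if joins s f then 1 else 0))
           (cong (K ℕ.*_) (all-by-evaluation (λ s → count (joins s) ℕ.≟ 2) s)))
  -- a member's special neighbours (7, 7 and 6 of them) are counted by evaluation
  degree (member T i) = trans
    (cong (7 ℕ.+_) (cong₂ ℕ._+_ (count-false {K})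
                              (cong₂ ℕ._+_ (count-≢₂ i (prev i) (prev-≢ i ∘ sym)) (cong (ℕ._+ 0) (count-≢ i)))))
    (arithmetic m)
    where arithmetic : ∀ m → 7 ℕ.+ (0 ℕ.+ (m ℕ.+ (suc m ℕ.+ 0))) ≡ 4 ℕ.+ (2 ℕ.+ m) ℕ.* 2
          arithmetic = solve-∀
  degree (member A i) = trans
    (cong (7 ℕ.+_) (cong₂ ℕ._+_ (count-≢-prev i) (cong₂ ℕ._+_ (count-≢ i) (cong (ℕ._+ 0) (count-false {K})))))
    (arithmetic m)
    where arithmetic : ∀ m → 7 ℕ.+ (m ℕ.+ (suc m ℕ.+ (0 ℕ.+ 0))) ≡ 4 ℕ.+ (2 ℕ.+ m) ℕ.* 2
          arithmetic = solve-∀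
  degree (member B i) = trans
    (cong (6 ℕ.+_) (cong₂ ℕ._+_ (trans (count-cong λ j → ≢ᵇ-sym i j) (count-≢ i))
                              (cong₂ ℕ._+_ (count-false {K}) (cong (ℕ._+ 0) (count-≢ i)))))
    (arithmetic m)
    where arithmetic : ∀ m → 6 ℕ.+ (suc m ℕ.+ (0 ℕ.+ (suc m ℕ.+ 0))) ≡ 4 ℕ.+ (2 ℕ.+ m) ℕ.* 2
          arithmetic = solve-∀

  regular : Regular G D
  regular u = trans (Σℕ-vertices (λ v → if adjV (dec u) v then 1 else 0)) (degree (dec u))

  open Distance G

  walk-start : ∀ w → reach G 0 (enc w) (enc w) ≡ true
  walk-start w = ⌊≟⌋-refl (enc w)

  walk-extend : ∀ {k u} w v → reach G k u (enc w) ≡ true → adjV w v ≡ true →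
                reach G (suc k) u (enc v) ≡ true
  walk-extend {k} {u} w v r e = reach-snoc {k} {u} {enc w} {enc v} r (trans (adj-enc w v) e)

  hub : Vertex → Vertex
  hub (special Q)  = member A zero
  hub (special R₁) = member A zero
  hub (special R₂) = member A zero
  hub (special _)  = member T zero
  hub (member B _) = special Y
  hub (member _ _) = special A₁

  hub-adjacent : ∀ w → adjV w (hub w) ≡ true × adjV (hub w) (special X) ≡ true
  hub-adjacent = all-vertices-by-evaluation λ w →
    (adjV w (hub w) Boolₚ.≟ true) ×-dec (adjV (hub w) (special X) Boolₚ.≟ true)

  walk-through-X : ∀ w v → reach G 4 (enc w) (enc v) ≡ true
  walk-through-X w v =
    walk-extend {3} {enc w} (hub v) v
      (walk-extend {2} {enc w} (special X) (hub v)
        (walk-extend {1} {enc w} (hub w) (special X)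
          (walk-extend {0} {enc w} w (hub w) (walk-start w) (proj₁ (hub-adjacent w)))
          (proj₂ (hub-adjacent w)))
        (trans (adjV-sym (special X) (hub v)) (proj₂ (hub-adjacent v))))
      (trans (adjV-sym (hub v) v) (proj₁ (hub-adjacent v)))

  short-walks : ShortWalks
  short-walks u v = 4 , s≤s (s≤s (s≤s (s≤s z≤n))) ,
    subst₂ (λ u v → reach G 4 u v ≡ true) (enc-dec u) (enc-dec v) (walk-through-X (dec u) (dec v))

  connected : Connected G
  connected u v = 4 , proj₂ (proj₂ (short-walks u v))

  familyLevel : Fin 3 → ℕ
  familyLevel T = 1
  familyLevel A = 2
  familyLevel B = 0

  specialLevel : Fin 2 → Fin 10 → ℕ
  specialLevel ℓY Y  = toℕ ℓY
  specialLevel _  X  = 1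
  specialLevel _  A₁ = 2
  specialLevel _  A₂ = 2
  specialLevel _  A₃ = 2
  specialLevel _  Q  = 1
  specialLevel _  R₁ = 1
  specialLevel _  R₂ = 1
  specialLevel _  _  = 0

  level : Fin 2 → Vertex → ℕ
  level ℓY (special s)  = specialLevel ℓY s
  level ℓY (member f _) = familyLevel f

  family-lipschitz : ∀ f g {i j} → adjF f g i j ≡ true → familyLevel f ℕ.≤ suc (familyLevel g)
  family-lipschitz T T ()
  family-lipschitz T A _ = ℕₚ.≤ᵇ⇒≤ 1 3 _
  family-lipschitz T B _ = ℕₚ.≤ᵇ⇒≤ 1 1 _
  family-lipschitz A T _ = ℕₚ.≤ᵇ⇒≤ 2 2 _
  family-lipschitz A A _ = ℕₚ.≤ᵇ⇒≤ 2 3 _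
  family-lipschitz A B ()
  family-lipschitz B T _ = ℕₚ.≤ᵇ⇒≤ 0 2 _
  family-lipschitz B A ()
  family-lipschitz B B _ = ℕₚ.≤ᵇ⇒≤ 0 1 _

  special-lipschitz : ∀ ℓY s s′ → edge s s′ ∨ edge s′ s ≡ true →
                      specialLevel ℓY s ℕ.≤ suc (specialLevel ℓY s′)
  special-lipschitz = all-by-evaluation λ ℓY → Finₚ.all? λ s → Finₚ.all? λ s′ →
    (edge s s′ ∨ edge s′ s Boolₚ.≟ true) →-dec (specialLevel ℓY s ℕ.≤? suc (specialLevel ℓY s′))

  special-member-lipschitz : ∀ ℓY s f → joins s f ≡ true →
    specialLevel ℓY s ℕ.≤ suc (familyLevel f) × familyLevel f ℕ.≤ suc (specialLevel ℓY s)
  special-member-lipschitz = all-by-evaluation λ ℓY → Finₚ.all? λ s → Finₚ.all? λ f →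
    (joins s f Boolₚ.≟ true) →-dec
    ((specialLevel ℓY s ℕ.≤? suc (familyLevel f)) ×-dec (familyLevel f ℕ.≤? suc (specialLevel ℓY s)))

  level-lipschitz : ∀ ℓY w v → adjV w v ≡ true → level ℓY w ℕ.≤ suc (level ℓY v)
  level-lipschitz ℓY (special s)  (special s′) e = special-lipschitz ℓY s s′ e
  level-lipschitz ℓY (special s)  (member f _) e = proj₁ (special-member-lipschitz ℓY s f e)
  level-lipschitz ℓY (member f _) (special s)  e = proj₂ (special-member-lipschitz ℓY s f e)
  level-lipschitz ℓY (member f i) (member g j) e = family-lipschitz f g {i} {j} e

  share : ℚ → ℚ
  share α = (1ℚ - α) * (ℤ.+ 1 / D)

  share-nonneg : ∀ {α} → α ≤ 1ℚ → 0ℚ ≤ share α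
  share-nonneg α≤1 = *-nonneg (p≤q⇒0≤q-p α≤1) (ℚₚ.<⇒≤ (1/suc-pos D-1))

  share-≤ : ∀ {α} → α ≤ 1ℚ → share α ≤ 1ℚ - α
  share-≤ {α} α≤1 = subst (share α ≤_) (ℚₚ.*-identityʳ (1ℚ - α))
    (ℚₚ.*-monoˡ-≤-nonNeg (1ℚ - α) {{nonNegative (p≤q⇒0≤q-p α≤1)}} (1/suc≤1 D-1))

  suc-D-shares : ∀ α → toℚ (suc D) * share α ≡ share α + (1ℚ - α)
  suc-D-shares α = begin
    toℚ (1 ℕ.+ D) * share α            ≡⟨ cong (_* share α) (toℚ-+ 1 D) ⟩
    (1ℚ + toℚ D) * share α             ≡⟨ ℚₚ.*-distribʳ-+ (share α) 1ℚ (toℚ D) ⟩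
    1ℚ * share α + toℚ D * share α     ≡⟨ cong₂ _+_ (ℚₚ.*-identityˡ (share α)) D-shares ⟩
    share α + (1ℚ - α)                 ∎
    where
    open ≡-Reasoning
    r : ℚ
    r = ℤ.+ 1 / D
    D-shares : toℚ D * share α ≡ 1ℚ - α
    D-shares = begin
      toℚ D * ((1ℚ - α) * r)   ≡⟨ ℚₚ.*-comm (toℚ D) ((1ℚ - α) * r) ⟩
      (1ℚ - α) * r * toℚ D     ≡⟨ ℚₚ.*-assoc (1ℚ - α) r (toℚ D) ⟩
      (1ℚ - α) * (r * toℚ D)   ≡⟨ cong ((1ℚ - α) *_) (trans (ℚₚ.*-comm r (toℚ D)) (toℚ-inverse D-1)) ⟩
      (1ℚ - α) * 1ℚ            ≡⟨ ℚₚ.*-identityʳ (1ℚ - α) ⟩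
      1ℚ - α                   ∎

  μᴹ : Mass → Vertex → Vertex → Mass
  μᴹ self w v = if ⌊ enc w ≟ enc v ⌋ then self else if adjV w v then (0 , 1) else (0 , 0)

  -- complementary slackness for the plan that sends g w from w to σ w
  data Tight (σ : Vertex → Vertex) (ℓ : Vertex → ℕ) (g : Vertex → Mass) (w : Vertex) : Set where
    idle      : g w ≡ (0 , 0) → Tight σ ℓ g w
    one-step  : adjV w (σ w) ≡ true → ℓ w ≡ 1 ℕ.+ ℓ (σ w) → Tight σ ℓ g w
    two-steps : ∀ v → adjV w v ≡ true → adjV v (σ w) ≡ true → ℓ w ≡ 2 ℕ.+ ℓ (σ w) → Tight σ ℓ g w

  module Plan (β ε : ℚ) (β≥0 : 0ℚ ≤ β) (ε≥0 : 0ℚ ≤ ε)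
              (σ : Vertex → Vertex) (σ-involutive : ∀ w → σ (σ w) ≡ w)
              (ℓ : Vertex → ℕ) (ℓ-lipschitz : ∀ w v → adjV w v ≡ true → ℓ w ℕ.≤ suc (ℓ v))
              (h g : Vertex → Mass) (tight : ∀ w → Tight σ ℓ g w) where

    open MassValue β ε
    open Transport G

    σᴺ : Fin N → Fin N
    σᴺ u = enc (σ (dec u))

    σᴺ-involutive : ∀ u → σᴺ (σᴺ u) ≡ u
    σᴺ-involutive u =
      trans (cong (enc ∘ σ) (dec-enc (σ (dec u)))) (trans (cong enc (σ-involutive (dec u))) (enc-dec u))

    ℓᴺ : Fin N → ℕ
    ℓᴺ = ℓ ∘ dec

    ℓᴺ-lipschitz : EdgeLipschitz ℓᴺ
    ℓᴺ-lipschitz u v = ℓ-lipschitz (dec u) (dec v)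

    F : Fin N → ℚ
    F = toℚ ∘ ℓᴺ

    short-route : ∀ w → g w ≡ (0 , 0) ⊎
                  ∃[ k ] k ℕ.≤ 2 × reach G k (enc w) (enc (σ w)) ≡ true × ℓ w ≡ k ℕ.+ ℓ (σ w)
    short-route w with tight w
    ... | idle g≡0              = inj₁ g≡0
    ... | one-step e ℓ≡         = inj₂ (1 , s≤s z≤n , walk-extend {0} {enc w} w (σ w) (walk-start w) e , ℓ≡)
    ... | two-steps v e e′ ℓ≡   =
      inj₂ (2 , ℕₚ.≤-refl ,
            walk-extend {1} {enc w} v (σ w) (walk-extend {0} {enc w} w v (walk-start w) e) e′ , ℓ≡)

    -- Below, routes are passed as arguments and the implicit arguments of the distance lemmas are
    -- given explicitly: letting Agda normalise dist G u v unfolds the exponential walk search.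
    Route : Fin N → Set
    Route u = g (dec u) ≡ (0 , 0) ⊎
              ∃[ k ] k ℕ.≤ N × reach G k u (σᴺ u) ≡ true × ℓ (dec u) ≡ k ℕ.+ ℓ (σ (dec u))

    route : ∀ u → Route u
    route u with short-route (dec u)
    ... | inj₁ g≡0 = inj₁ g≡0
    ... | inj₂ (k , k≤2 , r , ℓ≡) = inj₂ (k , ℕₚ.≤-trans k≤2 (ℕₚ.≤ᵇ⇒≤ 2 N _) ,
            subst (λ z → reach G k z (σᴺ u) ≡ true) (enc-dec u) r , ℓ≡)

    ℓᴺ-tight : ∀ {u k} → ℓ (dec u) ≡ k ℕ.+ ℓ (σ (dec u)) → ℓᴺ u ≡ k ℕ.+ ℓᴺ (σᴺ u)
    ℓᴺ-tight {u} {k} ℓ≡ = trans ℓ≡ (cong (λ z → k ℕ.+ ℓ z) (sym (dec-enc (σ (dec u)))))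

    slack : ∀ u → Route u → ⟦ g (dec u) ⟧ * (F u - F (σᴺ u)) ≡ ⟦ g (dec u) ⟧ * distℚ G u (σᴺ u)
    slack u (inj₁ g≡0) = trans (⟦0⟧-* g≡0 (F u - F (σᴺ u))) (sym (⟦0⟧-* g≡0 (distℚ G u (σᴺ u))))
    slack u (inj₂ (k , k≤N , r , ℓ≡)) =
      cong (⟦ g (dec u) ⟧ *_) (potential-tight {ℓᴺ} {k} {u} {σᴺ u} ℓᴺ-lipschitz r k≤N (ℓᴺ-tight {u} {k} ℓ≡))

    cost-mass : Vertex → Mass
    cost-mass w = (ℓ w ℕ.∸ ℓ (σ w)) · g w

    cost-pointwise : ∀ u → Route u → ⟦ g (dec u) ⟧ * distℚ G u (σᴺ u) ≡ ⟦ cost-mass (dec u) ⟧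
    cost-pointwise u (inj₁ g≡0) = begin
      ⟦ g (dec u) ⟧ * distℚ G u (σᴺ u) ≡⟨ ⟦0⟧-* g≡0 (distℚ G u (σᴺ u)) ⟩
      0ℚ                               ≡⟨ sym (⟦0⟧-* g≡0 (toℚ s)) ⟩
      ⟦ g (dec u) ⟧ * toℚ s            ≡⟨ ℚₚ.*-comm ⟦ g (dec u) ⟧ (toℚ s) ⟩
      toℚ s * ⟦ g (dec u) ⟧            ≡⟨ ⟦⟧-· s (g (dec u)) ⟩
      ⟦ cost-mass (dec u) ⟧            ∎
      where
      open ≡-Reasoning
      s : ℕ
      s = ℓ (dec u) ℕ.∸ ℓ (σ (dec u))
    cost-pointwise u (inj₂ (k , k≤N , r , ℓ≡)) = begin
      ⟦ g (dec u) ⟧ * toℚ (dist G u (σᴺ u)) ≡⟨ cong (λ d → ⟦ g (dec u) ⟧ * toℚ d) dist≡k ⟩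
      ⟦ g (dec u) ⟧ * toℚ k                 ≡⟨ ℚₚ.*-comm ⟦ g (dec u) ⟧ (toℚ k) ⟩
      toℚ k * ⟦ g (dec u) ⟧                 ≡⟨ ⟦⟧-· k (g (dec u)) ⟩
      ⟦ k · g (dec u) ⟧                     ≡⟨ cong (λ s → ⟦ s · g (dec u) ⟧) (sym step≡k) ⟩
      ⟦ cost-mass (dec u) ⟧                 ∎
      where
      open ≡-Reasoning
      dist≡k : dist G u (σᴺ u) ≡ k
      dist≡k = dist-tight {ℓᴺ} {k} {u} {σᴺ u} ℓᴺ-lipschitz r k≤N (ℓᴺ-tight {u} {k} ℓ≡)
      step≡k : ℓ (dec u) ℕ.∸ ℓ (σ (dec u)) ≡ k
      step≡k = trans (cong (ℕ._∸ ℓ (σ (dec u))) ℓ≡) (ℕₚ.m+n∸n≡m k (ℓ (σ (dec u))))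

    μ-mass : ∀ {α} self → ⟦ self ⟧ ≡ α → ⟦ 0 , 1 ⟧ ≡ share α →
             ∀ w v → μ G α (enc w) (enc v) ≡ ⟦ μᴹ self w v ⟧
    μ-mass {α} self self≡α share≡ w v =
      trans (μ-regular regular α (enc w) (enc v))
            (trans (cong (λ c → if ⌊ enc w ≟ enc v ⌋ then α else if c then share α else 0ℚ) (adj-enc w v))
                   (select ⌊ enc w ≟ enc v ⌋ (adjV w v)))
      where
      select : ∀ b c → (if b then α else if c then share α else 0ℚ) ≡
                       ⟦ if b then self else if c then (0 , 1) else (0 , 0) ⟧
      select true  _     = sym self≡α
      select false true  = sym share≡
      select false false = sym ⟦0⟧

    W1 : ∀ α self → ⟦ self ⟧ ≡ α → ⟦ 0 , 1 ⟧ ≡ share α →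
         (∀ w → h w ⊕ g w ≡ μᴹ self (special X) w) → (∀ w → h w ⊕ g (σ w) ≡ μᴹ self (special Y) w) →
         IsW1 G (μ G α x) (μ G α y) ⟦ Σℕ (proj₁ ∘ cost-mass ∘ dec) , Σℕ (proj₂ ∘ cost-mass ∘ dec) ⟧
    W1 α self self≡α share≡ rows cols =
      subst (IsW1 G (μ G α x) (μ G α y)) cost≡
        (IsW1-cong marginal-x marginal-y
          (plan-W1 (λ u → ⟦⟧-nonneg β≥0 ε≥0 (h (dec u))) (λ u → ⟦⟧-nonneg β≥0 ε≥0 (g (dec u)))
                   F (potential-lipschitz {ℓᴺ} short-walks ℓᴺ-lipschitz) (λ u → slack u (route u))))
      where
      open InvolutionPlan σᴺ σᴺ-involutive (⟦_⟧ ∘ h ∘ dec) (⟦_⟧ ∘ g ∘ dec)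
      open ≡-Reasoning

      marginal-x : ∀ u → ⟦ h (dec u) ⟧ + ⟦ g (dec u) ⟧ ≡ μ G α x u
      marginal-x u = begin
        ⟦ h (dec u) ⟧ + ⟦ g (dec u) ⟧     ≡⟨ sym (⟦⟧-⊕ (h (dec u)) (g (dec u))) ⟩
        ⟦ h (dec u) ⊕ g (dec u) ⟧         ≡⟨ cong ⟦_⟧ (rows (dec u)) ⟩
        ⟦ μᴹ self (special X) (dec u) ⟧   ≡⟨ sym (μ-mass self self≡α share≡ (special X) (dec u)) ⟩
        μ G α x (enc (dec u))             ≡⟨ cong (μ G α x) (enc-dec u) ⟩
        μ G α x u                         ∎

      marginal-y : ∀ v → ⟦ h (dec v) ⟧ + ⟦ g (dec (σᴺ v)) ⟧ ≡ μ G α y v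
      marginal-y v = begin
        ⟦ h (dec v) ⟧ + ⟦ g (dec (σᴺ v)) ⟧ ≡⟨ cong (λ w → ⟦ h (dec v) ⟧ + ⟦ g w ⟧) (dec-enc (σ (dec v))) ⟩
        ⟦ h (dec v) ⟧ + ⟦ g (σ (dec v)) ⟧  ≡⟨ sym (⟦⟧-⊕ (h (dec v)) (g (σ (dec v)))) ⟩
        ⟦ h (dec v) ⊕ g (σ (dec v)) ⟧      ≡⟨ cong ⟦_⟧ (cols (dec v)) ⟩
        ⟦ μᴹ self (special Y) (dec v) ⟧    ≡⟨ sym (μ-mass self self≡α share≡ (special Y) (dec v)) ⟩
        μ G α y (enc (dec v))              ≡⟨ cong (μ G α y) (enc-dec v) ⟩
        μ G α y v                          ∎

      cost≡ : Σℚ (λ u → ⟦ g (dec u) ⟧ * distℚ G u (σᴺ u)) ≡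
              ⟦ Σℕ (proj₁ ∘ cost-mass ∘ dec) , Σℕ (proj₂ ∘ cost-mass ∘ dec) ⟧
      cost≡ = trans (Σℚ-cong λ u → cost-pointwise u (route u)) (Σℚ-⟦⟧ (cost-mass ∘ dec))

  swapAB : Fin 3 → Fin 3
  swapAB A = B
  swapAB B = A
  swapAB f = f

  τ-near-one : Fin 10 → Fin 10
  τ-near-one X  = Y
  τ-near-one Y  = X
  τ-near-one A₁ = B₁
  τ-near-one B₁ = A₁
  τ-near-one A₂ = B₂
  τ-near-one B₂ = A₂
  τ-near-one A₃ = Q
  τ-near-one Q  = A₃
  τ-near-one s  = s

  τ-at-zero : Fin 10 → Fin 10
  τ-at-zero X  = A₁
  τ-at-zero A₁ = X
  τ-at-zero Y  = B₁
  τ-at-zero B₁ = Y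
  τ-at-zero A₂ = B₂
  τ-at-zero B₂ = A₂
  τ-at-zero A₃ = Q
  τ-at-zero Q  = A₃
  τ-at-zero s  = s

  τ-near-one-involutive : ∀ s → τ-near-one (τ-near-one s) ≡ s
  τ-near-one-involutive = all-by-evaluation λ s → τ-near-one (τ-near-one s) ≟ s

  τ-at-zero-involutive : ∀ s → τ-at-zero (τ-at-zero s) ≡ s
  τ-at-zero-involutive = all-by-evaluation λ s → τ-at-zero (τ-at-zero s) ≟ s

  lift-involution : (Fin 10 → Fin 10) → Vertex → Vertex
  lift-involution τ (special s)  = special (τ s)
  lift-involution τ (member f i) = member (swapAB f) i

  lift-involution-involutive : ∀ τ → (∀ s → τ (τ s) ≡ s) → ∀ w → lift-involution τ (lift-involution τ w) ≡ w
  lift-involution-involutive τ τ-involutive (special s)  = cong special (τ-involutive s)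
  lift-involution-involutive τ τ-involutive (member T i) = refl
  lift-involution-involutive τ τ-involutive (member A i) = refl
  lift-involution-involutive τ τ-involutive (member B i) = refl

  module NearOne (α : ℚ) (½<α : ½ < α) (α<1 : α < 1ℚ) where

    ε β : ℚ
    ε = share α
    β = α - ε

    ε≥0 : 0ℚ ≤ ε
    ε≥0 = share-nonneg (ℚₚ.<⇒≤ α<1)

    β≥0 : 0ℚ ≤ β
    β≥0 = p≤q⇒0≤q-p (ℚₚ.≤-trans (share-≤ (ℚₚ.<⇒≤ α<1)) (ℚₚ.<⇒≤ 1-α<α))
      where
      1-α<α : 1ℚ - α < α
      1-α<α = ℚₚ.<-trans (ℚₚ.+-monoʳ-< 1ℚ (ℚₚ.neg-antimono-< ½<α)) ½<α

    σ : Vertex → Vertex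
    σ = lift-involution τ-near-one

    ℓ : Vertex → ℕ
    ℓ = level 0F

    h g : Vertex → Mass
    h (special X)  = 0 , 1
    h (special Y)  = 0 , 1
    h (member T _) = 0 , 1
    h _            = 0 , 0
    g (special X)  = 1 , 0
    g (special A₁) = 0 , 1
    g (special A₂) = 0 , 1
    g (special A₃) = 0 , 1
    g (member A _) = 0 , 1
    g _            = 0 , 0

    tight : ∀ w → Tight σ ℓ g w
    tight (special X)  = one-step refl refl
    tight (special Y)  = idle refl
    tight (special A₁) = two-steps (member T zero) refl refl refl
    tight (special A₂) = two-steps (member T zero) refl refl refl
    tight (special A₃) = one-step refl refl
    tight (special Q)  = idle refl
    tight (special B₁) = idle refl
    tight (special B₂) = idle refl
    tight (special R₁) = idle refl
    tight (special R₂) = idle refl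
    tight (member T _) = idle refl
    tight (member A _) = two-steps (special Q) refl refl refl
    tight (member B _) = idle refl

    open Plan β ε β≥0 ε≥0 σ (lift-involution-involutive τ-near-one τ-near-one-involutive)
              ℓ (level-lipschitz 0F) h g tight
    open MassValue β ε

    W1≡1 : IsW1 G (μ G α x) (μ G α y) 1ℚ
    W1≡1 = subst (IsW1 G (μ G α x) (μ G α y)) value (W1 α (1 , 1) self≡α share≡ε rows cols)
      where
      open ≡-Reasoning
      open +-*-Solver using (solve; con; _:+_; _:*_; _:-_; _:=_)
      rows : ∀ w → h w ⊕ g w ≡ μᴹ (1 , 1) (special X) w
      rows = all-vertices-by-evaluation λ w → h w ⊕ g w ≟ᴹ μᴹ (1 , 1) (special X) w
      cols : ∀ w → h w ⊕ g (σ w) ≡ μᴹ (1 , 1) (special Y) w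
      cols = all-vertices-by-evaluation λ w → h w ⊕ g (σ w) ≟ᴹ μᴹ (1 , 1) (special Y) w
      self≡α : ⟦ 1 , 1 ⟧ ≡ α
      self≡α = solve 2 (λ a e → con 1ℚ :* (a :- e) :+ con 1ℚ :* e := a) refl α ε
      share≡ε : ⟦ 0 , 1 ⟧ ≡ ε
      share≡ε = trans (cong (_+ 1ℚ * ε) (ℚₚ.*-zeroˡ β)) (solve 1 (λ e → con 0ℚ :+ con 1ℚ :* e := e) refl ε)
      -- cost-mass is constant on each family, which Agda checks by evaluation when Σℕ-families applies
      coefficients : (Σℕ (proj₁ ∘ cost-mass ∘ dec) , Σℕ (proj₂ ∘ cost-mass ∘ dec)) ≡ (1 , suc D)
      coefficients = cong₂ _,_
        (trans (Σℕ-vertices (proj₁ ∘ cost-mass))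
               (cong (1 ℕ.+_) (trans (Σℕ-families (proj₁ ∘ cost-mass ∘ representative)) (ℕₚ.*-zeroʳ K))))
        (trans (Σℕ-vertices (proj₂ ∘ cost-mass))
               (cong (5 ℕ.+_) (Σℕ-families (proj₂ ∘ cost-mass ∘ representative))))
      value : ⟦ Σℕ (proj₁ ∘ cost-mass ∘ dec) , Σℕ (proj₂ ∘ cost-mass ∘ dec) ⟧ ≡ 1ℚ
      value = begin
        ⟦ Σℕ (proj₁ ∘ cost-mass ∘ dec) , Σℕ (proj₂ ∘ cost-mass ∘ dec) ⟧ ≡⟨ cong ⟦_⟧ coefficients ⟩
        1ℚ * β + toℚ (suc D) * ε                                      ≡⟨ cong (1ℚ * β +_) (suc-D-shares α) ⟩
        1ℚ * (α - ε) + (ε + (1ℚ - α))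
          ≡⟨ solve 2 (λ a e → con 1ℚ :* (a :- e) :+ (e :+ (con 1ℚ :- a)) := con 1ℚ) refl α ε ⟩
        1ℚ ∎

  module AtZero where

    ε : ℚ
    ε = share 0ℚ

    ε>0 : 0ℚ < ε
    ε>0 = subst (0ℚ <_) (sym (ℚₚ.*-identityˡ (ℤ.+ 1 / D))) (1/suc-pos D-1)

    σ : Vertex → Vertex
    σ = lift-involution τ-at-zero

    ℓ : Vertex → ℕ
    ℓ = level 1F

    h g : Vertex → Mass
    h (member T _) = 0 , 1
    h _            = 0 , 0
    g (special Y)  = 0 , 1
    g (special A₁) = 0 , 1
    g (special A₂) = 0 , 1
    g (special A₃) = 0 , 1
    g (member A _) = 0 , 1
    g _            = 0 , 0

    tight : ∀ w → Tight σ ℓ g w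
    tight (special X)  = idle refl
    tight (special Y)  = one-step refl refl
    tight (special A₁) = one-step refl refl
    tight (special A₂) = two-steps (member T zero) refl refl refl
    tight (special A₃) = one-step refl refl
    tight (special Q)  = idle refl
    tight (special B₁) = idle refl
    tight (special B₂) = idle refl
    tight (special R₁) = idle refl
    tight (special R₂) = idle refl
    tight (member T _) = idle refl
    tight (member A _) = two-steps (special Q) refl refl refl
    tight (member B _) = idle refl

    open Plan 0ℚ ε ℚₚ.≤-refl (ℚₚ.<⇒≤ ε>0) σ (lift-involution-involutive τ-at-zero τ-at-zero-involutive)
              ℓ (level-lipschitz 1F) h g tight
    open MassValue 0ℚ ε

    W1≡1+ε : IsW1 G (μ G 0ℚ x) (μ G 0ℚ y) (1ℚ + ε)
    W1≡1+ε = subst (IsW1 G (μ G 0ℚ x) (μ G 0ℚ y)) value (W1 0ℚ (0 , 0) ⟦0⟧ share≡ε rows cols)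
      where
      open ≡-Reasoning
      rows : ∀ w → h w ⊕ g w ≡ μᴹ (0 , 0) (special X) w
      rows = all-vertices-by-evaluation λ w → h w ⊕ g w ≟ᴹ μᴹ (0 , 0) (special X) w
      cols : ∀ w → h w ⊕ g (σ w) ≡ μᴹ (0 , 0) (special Y) w
      cols = all-vertices-by-evaluation λ w → h w ⊕ g (σ w) ≟ᴹ μᴹ (0 , 0) (special Y) w
      share≡ε : ⟦ 0 , 1 ⟧ ≡ ε
      share≡ε = trans (ℚₚ.+-identityˡ (1ℚ * ε)) (ℚₚ.*-identityˡ ε)
      coefficients : (Σℕ (proj₁ ∘ cost-mass ∘ dec) , Σℕ (proj₂ ∘ cost-mass ∘ dec)) ≡ (0 , suc D)
      coefficients = cong₂ _,_
        (trans (Σℕ-vertices (proj₁ ∘ cost-mass))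
               (trans (Σℕ-families (proj₁ ∘ cost-mass ∘ representative)) (ℕₚ.*-zeroʳ K)))
        (trans (Σℕ-vertices (proj₂ ∘ cost-mass))
               (cong (5 ℕ.+_) (Σℕ-families (proj₂ ∘ cost-mass ∘ representative))))
      value : ⟦ Σℕ (proj₁ ∘ cost-mass ∘ dec) , Σℕ (proj₂ ∘ cost-mass ∘ dec) ⟧ ≡ 1ℚ + ε
      value = begin
        ⟦ Σℕ (proj₁ ∘ cost-mass ∘ dec) , Σℕ (proj₂ ∘ cost-mass ∘ dec) ⟧ ≡⟨ cong ⟦_⟧ coefficients ⟩
        0ℚ + toℚ (suc D) * ε                                          ≡⟨ ℚₚ.+-identityˡ _ ⟩
        toℚ (suc D) * ε                                               ≡⟨ suc-D-shares 0ℚ ⟩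
        ε + 1ℚ                                                        ≡⟨ ℚₚ.+-comm ε 1ℚ ⟩
        1ℚ + ε                                                        ∎

  curvature-example : CurvatureExample N D
  curvature-example =
    G , connected , regular , x , y , refl , LLY , 1ℚ - (1ℚ + AtZero.ε) , κ-from-W1 AtZero.W1≡1+ε , κ₀<0
    where
    unit-distance : distℚ G x y ≡ 1ℚ
    unit-distance = sym (potential-tight {level 0F ∘ dec} {1} {x} {y}
      (λ u v → level-lipschitz 0F (dec u) (dec v))
      (walk-extend {0} {x} (special X) (special Y) (walk-start (special X)) refl) (s≤s z≤n) refl)
    open Curvature G {x} {y} unit-distance
    LLY : IsLLY G x y 0ℚ
    LLY = LLY-zero ½ (ℚₚ.positive⁻¹ ½) (λ α ½<α α<1 → κ-from-W1 (NearOne.W1≡1 α ½<α α<1))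
    κ₀<0 : 1ℚ - (1ℚ + AtZero.ε) < 0ℚ
    κ₀<0 = subst (_< 0ℚ) (sym (solve 1 (λ e → con 1ℚ :- (con 1ℚ :+ e) := :- e) refl AtZero.ε))
                 (ℚₚ.neg-antimono-< AtZero.ε>0)
      where open +-*-Solver using (solve; con; _:+_; _:-_; :-_; _:=_)

open import Data.Nat using (ℕ; _+_; _*_; _≤_)
open import Data.Nat.Divisibility using (_∣_)
open import Data.Rational using (0ℚ; 1ℚ) renaming (_<_ to _<ℚ_)

mainTheorem17 : (n d : ℕ) → 3 * d + 8 ≡ 2 * n → 2 ∣ d → 12 ≤ d →
    Σ (SimpleGraph n) λ G → Connected G × Regular G d ×
      Σ (Fin n) λ x → Σ (Fin n) λ y → adj G x y ≡ true ×
        IsLLY G x y 0ℚ ×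
        Σ _ λ k → IsKappaα G 0ℚ x y k × k <ℚ 0ℚ
mainTheorem17 n d 3d+8≡2n (divides q d≡q*2) 12≤d =
  subst₂ CurvatureExample (sym n≡N) (sym d≡D) curvature-example
  where
  -- the construction only needs d ≥ 8
  4≤q : 4 ≤ q
  4≤q = ℕₚ.*-cancelʳ-≤ 4 q 2 (ℕₚ.≤-trans (ℕₚ.≤ᵇ⇒≤ 8 12 _) (subst (12 ≤_) d≡q*2 12≤d))
  m : ℕ
  m = q ℕ.∸ 4
  open Construction m using (N; D; curvature-example)
  d≡D : d ≡ D
  d≡D = trans d≡q*2 (cong (_* 2) (sym (ℕₚ.m+[n∸m]≡n 4≤q)))
  n≡N : n ≡ N
  n≡N = ℕₚ.*-cancelˡ-≡ n N 2 (trans (sym 3d+8≡2n) (trans (cong (λ d → 3 * d + 8) d≡D) (arithmetic m)))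
    where arithmetic : ∀ m → 3 * (4 + (2 + m) * 2) + 8 ≡ 2 * (10 + 3 * (2 + m))
          arithmetic = solve-∀
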